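{- Let $N$ be a homogeneous network with asymmetric inputs and $\tilde{N}$ its fundamental network. For an edge type $i$, let $A_i$ be the adjacency matrix of $N$ and $\tilde{A}_i$ the adjacency matrix of $\tilde{N}$ for edge type $i$. Then $A_i$ is non-singular if and only if $\tilde{A}_i$ is non-singular.
   Context: A homogeneous network with asymmetric inputs has a finite cell set $C$, one cell type, $k$ edge types, each cell receiving exactly one edge of each type; it is represented by $\sigma_1,\dots,\sigma_k:C\to C$ (type-$i$ edge into $c$ comes from $\sigma_i(c)$). The fundamental network $\tilde{N}$ has as cells the semigroup $\tilde{C}$ of maps $C\to C$ generated under composition by $Id_C,\sigma_1,\dots,\sigma_k$, represented by $\tilde{\sigma}_i(\gamma)=\sigma_i\circ\gamma$. For a network with cells $\{1,\dots,n\}$, the adjacency matrix $A_i$ for edge type $i$ is the $n\times n$ matrix whose $(c,c')$ entry is the number of edges of type $i$ from $c'$ to $c$. -}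

module Defs where

open import Data.Nat using (ℕ; zero; suc)
open import Data.Integer using (ℤ; +_; _+_; _*_; -_)
open import Data.Fin using (Fin; zero; suc; punchIn; toℕ)
open import Data.Vec using (Vec; tabulate; map; lookup)
open import Data.Vec.Properties using (≡-dec)
open import Data.Fin.Properties using (_≟_)
open import Data.Product using (Σ; ∃; _×_)
open import Relation.Nullary using (yes; no)
open import Relation.Binary.PropositionalEquality using (_≡_)
open import Function using (id)

sumFin : ∀ n → (Fin n → ℤ) → ℤ
sumFin zero    f = + 0
sumFin (suc n) f = f zero + sumFin n (λ j → f (suc j))

sign : ℕ → ℤ
sign zero          = + 1
sign (suc zero)    = - (+ 1)
sign (suc (suc k)) = sign k

Matrix : ℕ → Set
Matrix n = Fin n → Fin n → ℤ

det : ∀ n → Matrix n → ℤ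
det zero    M = + 1
det (suc n) M =
  sumFin (suc n) (λ j → sign (toℕ j) * (M zero j * det n (λ r c → M (suc r) (punchIn j c))))

-- A square matrix is non-singular iff its determinant is non-zero.
-- (For an integer matrix this is the same over ℤ, ℚ, ℝ or ℂ.)
NonSingular : ∀ n → Matrix n → Set
NonSingular n M = (det n M ≡ + 0) → Data.Empty.⊥
  where import Data.Empty

-- A homogeneous network with asymmetric inputs on cells Fin n with k edge
-- types is given by σ : Fin k → Fin n → Fin n; the type-i edge into c comes
-- from σ i c.

-- Adjacency matrix A_i: entry (c , c') = number of type-i edges from c' to c,
-- which is 1 if σ i c = c' and 0 otherwise.
adjacency : ∀ {n k} → (Fin k → Fin n → Fin n) → Fin k → Matrix n
adjacency σ i c c' with σ i c ≟ c'
... | yes _ = + 1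
... | no  _ = + 0

-- Maps C → C are represented by their table of values: γ ↦ vector v with
-- lookup v c = γ c.  Composition (u ∘ v) is  map (lookup u) v.
Map : ℕ → Set
Map n = Vec (Fin n) n

idMap : ∀ {n} → Map n
idMap = tabulate id

_∘ₘ_ : ∀ {n} → Map n → Map n → Map n
u ∘ₘ v = map (lookup u) v

_≟ₘ_ : ∀ {n} (u v : Map n) → Relation.Nullary.Dec (u ≡ v)
_≟ₘ_ = ≡-dec _≟_

data InC̃ {n k : ℕ} (σ : Fin k → Fin n → Fin n) : Map n → Set where
  gen-id   : InC̃ σ idMap
  gen-σ    : ∀ i → InC̃ σ (tabulate (σ i))
  gen-comp : ∀ {u v} → InC̃ σ u → InC̃ σ v → InC̃ σ (u ∘ₘ v)

record Enumeration {n k : ℕ} (σ : Fin k → Fin n → Fin n) (m : ℕ) : Set where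
  field
    elt       : Fin m → Map n
    elt-in    : ∀ a → InC̃ σ (elt a)
    injective : ∀ a b → elt a ≡ elt b → a ≡ b
    surjective : ∀ v → InC̃ σ v → ∃ λ a → elt a ≡ v

-- Edge of type i into γ comes from σ̃_i(γ) = σ_i ∘ γ, so
-- entry (γ , γ') is 1 if σ_i ∘ γ = γ' and 0 otherwise.
fundamentalAdjacency : ∀ {n k m} (σ : Fin k → Fin n → Fin n) →
  Enumeration σ m → Fin k → Matrix m
fundamentalAdjacency σ e i a b with (tabulate (σ i) ∘ₘ Enumeration.elt e a) ≟ₘ Enumeration.elt e b
... | yes _ = + 1
... | no  _ = + 0

-- The adjacency matrix of an edge type in a network with asymmetric inputs is
-- the 0/1 matrix of a map f (a single 1 per row, in column f r), and such a
-- matrix is non-singular exactly when f is injective: Laplace expansion along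
-- a row leaves, up to sign, the matrix of f with one row and one column
-- deleted.  So it remains to compare injectivity of σᵢ on C with that of
-- σ̃ᵢ = σᵢ ∘ _ on C̃.  Left cancellation of an injective σᵢ makes σ̃ᵢ
-- injective.  Conversely an injective self-map of the finite set C̃ is onto,
-- so Id = σᵢ ∘ γ for some γ ∈ C̃, and a map of C with a right inverse is
-- injective.
module Submission where

open import Defs
open import Data.Nat using (ℕ; zero; suc)
import Data.Nat.Properties as ℕP
open import Data.Fin using (Fin; zero; suc; punchIn; punchOut; toℕ)
open import Data.Fin.Properties
  using (_≟_; any?; injective⇒≤; suc-injective; punchInᵢ≢i; punchIn-punchOut; punchOut-punchIn;
         punchOut-cong; punchOut-injective)
open import Data.Integer using (ℤ; +_; _+_; _*_)
import Data.Integer.Properties as ℤP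
open import Data.Maybe using (Maybe; just; nothing)
open import Data.Maybe.Properties using (just-injective)
open import Data.Product using (_×_; _,_; proj₁; proj₂; ∃)
open import Data.Empty using (⊥-elim)
open import Data.Vec using (lookup; tabulate)
open import Data.Vec.Properties using (lookup-map; lookup∘tabulate)
open import Data.Vec.Relation.Binary.Pointwise.Extensional using (ext; Pointwise-≡⇒≡)
open import Function using (_∘_; case_of_; _⇔_; mk⇔; Equivalence)
open import Function.Definitions using (Injective)
open import Function.Properties.Equivalence using (⇔-setoid)
open import Function.Construct.Symmetry using (⇔-sym)
open import Function.Construct.Composition using (_⇔-∘_)
open import Level using (0ℓ)
open import Relation.Nullary using (yes; no)
open import Relation.Binary.PropositionalEquality
import Relation.Binary.Reasoning.Setoid as SetoidReasoning

injective⇒surjective : ∀ {m} {f : Fin m → Fin m} → Injective _≡_ _≡_ f →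
  ∀ y → ∃ λ x → f x ≡ y
injective⇒surjective {f = f} f-injective y with any? (λ x → f x ≟ y)
... | yes hit = hit
injective⇒surjective {suc m} {f} f-injective y | no miss =
  ⊥-elim (ℕP.<-irrefl refl (injective⇒≤ punchOut-y∘f-injective))
  where
  y≢f : ∀ x → y ≢ f x
  y≢f x y≡fx = miss (x , sym y≡fx)

  punchOut-y∘f-injective : Injective _≡_ _≡_ (λ x → punchOut (y≢f x))
  punchOut-y∘f-injective eq = f-injective (punchOut-injective (y≢f _) (y≢f _) eq)

rightInverse⇒injective : ∀ {n} {f g : Fin n → Fin n} → (∀ x → f (g x) ≡ x) →
  Injective _≡_ _≡_ f
rightInverse⇒injective {f = f} {g} f∘g≡id {x} {y} = f-injective x y
  where
  g-injective : Injective _≡_ _≡_ g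
  g-injective {a} {b} ga≡gb = trans (sym (f∘g≡id a)) (trans (cong f ga≡gb) (f∘g≡id b))

  f-injective : ∀ x y → f x ≡ f y → x ≡ y
  f-injective x y fx≡fy
    with x′ , refl ← injective⇒surjective g-injective x
       | y′ , refl ← injective⇒surjective g-injective y
    = cong g (trans (sym (f∘g≡id x′)) (trans fx≡fy (f∘g≡id y′)))

sumFin-zero : ∀ n {f : Fin n → ℤ} → (∀ j → f j ≡ + 0) → sumFin n f ≡ + 0
sumFin-zero zero    f≡0 = refl
sumFin-zero (suc n) f≡0 = cong₂ _+_ (f≡0 zero) (sumFin-zero n (f≡0 ∘ suc))

sumFin-single : ∀ n {f : Fin n → ℤ} j → (∀ c → c ≢ j → f c ≡ + 0) → sumFin n f ≡ f j
sumFin-single (suc n) {f} zero    f≡0 =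
  trans (cong (λ s → f zero + s) (sumFin-zero n (λ c → f≡0 (suc c) λ ())))
        (ℤP.+-identityʳ (f zero))
sumFin-single (suc n) {f} (suc j) f≡0 =
  trans (cong (_+ sumFin n (f ∘ suc)) (f≡0 zero λ ()))
        (trans (ℤP.+-identityˡ _)
               (sumFin-single n j (λ c c≢j → f≡0 (suc c) (c≢j ∘ suc-injective))))

minor : ∀ {n} → Fin (suc n) → Matrix (suc n) → Matrix n
minor j M r c = M (suc r) (punchIn j c)

det-zeroRow : ∀ n (M : Matrix n) r → (∀ c → M r c ≡ + 0) → det n M ≡ + 0
det-zeroRow (suc n) M zero    row≡0 = sumFin-zero (suc n) λ j →
  trans (cong (λ x → sign (toℕ j) * (x * det n (minor j M))) (row≡0 j))
        (ℤP.*-zeroʳ (sign (toℕ j)))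
det-zeroRow (suc n) M (suc r) row≡0 = sumFin-zero (suc n) λ j → begin
  sign (toℕ j) * (M zero j * det n (minor j M))
    ≡⟨ cong (λ d → sign (toℕ j) * (M zero j * d))
            (det-zeroRow n (minor j M) r (row≡0 ∘ punchIn j)) ⟩
  sign (toℕ j) * (M zero j * + 0)
    ≡⟨ cong (sign (toℕ j) *_) (ℤP.*-zeroʳ (M zero j)) ⟩
  sign (toℕ j) * + 0
    ≡⟨ ℤP.*-zeroʳ (sign (toℕ j)) ⟩
  + 0 ∎
  where open ≡-Reasoning

det-singleEntryRow : ∀ n (M : Matrix (suc n)) j → (∀ c → c ≢ j → M zero c ≡ + 0) →
  det (suc n) M ≡ sign (toℕ j) * (M zero j * det n (minor j M))
det-singleEntryRow n M j off≡0 = sumFin-single (suc n) j λ c c≢j →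
  trans (cong (λ x → sign (toℕ c) * (x * det n (minor c M))) (off≡0 c c≢j))
        (ℤP.*-zeroʳ (sign (toℕ c)))

sign²≡1 : ∀ k → sign k * sign k ≡ + 1
sign²≡1 zero          = refl
sign²≡1 (suc zero)    = refl
sign²≡1 (suc (suc k)) = sign²≡1 k

sign-*-≡0⇒≡0 : ∀ k x → sign k * x ≡ + 0 → x ≡ + 0
sign-*-≡0⇒≡0 k x sx≡0 = begin
  x                        ≡⟨ sym (ℤP.*-identityˡ x) ⟩
  + 1 * x                  ≡⟨ cong (_* x) (sym (sign²≡1 k)) ⟩
  sign k * sign k * x      ≡⟨ ℤP.*-assoc (sign k) (sign k) x ⟩
  sign k * (sign k * x)    ≡⟨ cong (sign k *_) sx≡0 ⟩
  sign k * + 0             ≡⟨ ℤP.*-zeroʳ (sign k) ⟩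
  + 0                      ∎
  where open ≡-Reasoning

nonSingular⇔-signed : ∀ {m n} (M : Matrix m) (N : Matrix n) k →
  det m M ≡ sign k * det n N → NonSingular m M ⇔ NonSingular n N
nonSingular⇔-signed {m} {n} M N k detM≡±detN = mk⇔
  (λ nsM detN≡0 → nsM (trans detM≡±detN (trans (cong (sign k *_) detN≡0) (ℤP.*-zeroʳ (sign k)))))
  (λ nsN detM≡0 → nsN (sign-*-≡0⇒≡0 k (det n N) (trans (sym detM≡±detN) detM≡0)))

PartialMap : ℕ → Set
PartialMap n = Fin n → Maybe (Fin n)

IsMatrixOf : ∀ {n} → Matrix n → PartialMap n → Set
IsMatrixOf M g = ∀ r c → (g r ≡ just c → M r c ≡ + 1) × (g r ≢ just c → M r c ≡ + 0)

Total : ∀ {n} → PartialMap n → Set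
Total g = ∀ r → ∃ λ c → g r ≡ just c

PartialInjective : ∀ {n} → PartialMap n → Set
PartialInjective g = ∀ {r s c} → g r ≡ just c → g s ≡ just c → r ≡ s

nothing≢just : ∀ {A : Set} {x : A} → nothing ≢ just x
nothing≢just ()

punchOutMaybe : ∀ {n} → Fin (suc n) → Maybe (Fin (suc n)) → Maybe (Fin n)
punchOutMaybe j nothing = nothing
punchOutMaybe j (just c) with j ≟ c
... | yes _   = nothing
... | no j≢c  = just (punchOut j≢c)

punchOutMaybe-just⁻¹ : ∀ {n} (j : Fin (suc n)) x {c} →
  punchOutMaybe j x ≡ just c → x ≡ just (punchIn j c)
punchOutMaybe-just⁻¹ j (just d) eq with j ≟ d
... | no j≢d = cong just (trans (sym (punchIn-punchOut j≢d)) (cong (punchIn j) (just-injective eq)))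

punchOutMaybe-≢ : ∀ {n} {j c : Fin (suc n)} (j≢c : j ≢ c) →
  punchOutMaybe j (just c) ≡ just (punchOut j≢c)
punchOutMaybe-≢ {j = j} {c} j≢c with j ≟ c
... | yes j≡c  = ⊥-elim (j≢c j≡c)
... | no _     = cong just (punchOut-cong j refl)

punchOutMaybe-self : ∀ {n} (j : Fin (suc n)) → punchOutMaybe j (just j) ≡ nothing
punchOutMaybe-self j with j ≟ j
... | yes _    = refl
... | no j≢j   = ⊥-elim (j≢j refl)

punchOutMaybe-punchIn : ∀ {n} (j : Fin (suc n)) c →
  punchOutMaybe j (just (punchIn j c)) ≡ just c
punchOutMaybe-punchIn j c =
  trans (punchOutMaybe-≢ (punchInᵢ≢i j c ∘ sym)) (cong just (punchOut-punchIn j))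

-- Rows of g that hit the deleted column j become undefined.
minorMap : ∀ {n} → Fin (suc n) → PartialMap (suc n) → PartialMap n
minorMap j g r = punchOutMaybe j (g (suc r))

isMatrixOf-minor : ∀ {n} {M : Matrix (suc n)} {g} j → IsMatrixOf M g →
  IsMatrixOf (minor j M) (minorMap j g)
isMatrixOf-minor {g = g} j M≅g r c =
    (λ g′r≡c → proj₁ (M≅g (suc r) (punchIn j c)) (punchOutMaybe-just⁻¹ j (g (suc r)) g′r≡c))
  , (λ g′r≢c → proj₂ (M≅g (suc r) (punchIn j c)) λ gr≡jc →
       g′r≢c (trans (cong (punchOutMaybe j) gr≡jc) (punchOutMaybe-punchIn j c)))

det-isMatrixOf : ∀ {n} {M : Matrix (suc n)} {g} {j} → IsMatrixOf M g → g zero ≡ just j →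
  det (suc n) M ≡ sign (toℕ j) * det n (minor j M)
det-isMatrixOf {n} {M} {g} {j} M≅g g₀≡j = begin
  det (suc n) M
    ≡⟨ det-singleEntryRow n M j (λ c c≢j → proj₂ (M≅g zero c) λ g₀≡c →
         c≢j (just-injective (trans (sym g₀≡c) g₀≡j))) ⟩
  sign (toℕ j) * (M zero j * det n (minor j M))
    ≡⟨ cong (λ x → sign (toℕ j) * (x * det n (minor j M))) (proj₁ (M≅g zero j) g₀≡j) ⟩
  sign (toℕ j) * (+ 1 * det n (minor j M))
    ≡⟨ cong (sign (toℕ j) *_) (ℤP.*-identityˡ (det n (minor j M))) ⟩
  sign (toℕ j) * det n (minor j M) ∎
  where open ≡-Reasoning

module _ {n} {g : PartialMap (suc n)} {j : Fin (suc n)} (g₀≡j : g zero ≡ just j) where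

  minorMap-total : Total g → PartialInjective g → Total (minorMap j g)
  minorMap-total total injective r with c , gr≡c ← total (suc r) | j ≟ c
  ... | yes refl = case injective gr≡c g₀≡j of λ ()
  ... | no j≢c   = punchOut j≢c , trans (cong (punchOutMaybe j) gr≡c) (punchOutMaybe-≢ j≢c)

  minorMap-injective : PartialInjective g → PartialInjective (minorMap j g)
  minorMap-injective injective {r} {s} g′r≡c g′s≡c = suc-injective (injective
    (punchOutMaybe-just⁻¹ j (g (suc r)) g′r≡c) (punchOutMaybe-just⁻¹ j (g (suc s)) g′s≡c))

  total-fromMinor : Total (minorMap j g) → Total g
  total-fromMinor total′ zero    = j , g₀≡j
  total-fromMinor total′ (suc r) =
    let c , g′r≡c = total′ r in punchIn j c , punchOutMaybe-just⁻¹ j (g (suc r)) g′r≡c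

  minorMap-total⇒misses : Total (minorMap j g) → ∀ s → g (suc s) ≢ just j
  minorMap-total⇒misses total′ s gs≡j = nothing≢just (begin
    nothing                        ≡⟨ sym (punchOutMaybe-self j) ⟩
    punchOutMaybe j (just j)       ≡⟨ cong (punchOutMaybe j) (sym gs≡j) ⟩
    minorMap j g s                 ≡⟨ proj₂ (total′ s) ⟩
    just (proj₁ (total′ s))        ∎)
    where open ≡-Reasoning

  injective-fromMinor : Total (minorMap j g) → PartialInjective (minorMap j g) → PartialInjective g
  injective-fromMinor total′ injective′ {zero}  {zero}  _      _      = refl
  injective-fromMinor total′ injective′ {zero}  {suc s} g₀≡c   gs≡c   =
    ⊥-elim (minorMap-total⇒misses total′ s (trans gs≡c (trans (sym g₀≡c) g₀≡j)))
  injective-fromMinor total′ injective′ {suc r} {zero}  gr≡c   g₀≡c   =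
    ⊥-elim (minorMap-total⇒misses total′ r (trans gr≡c (trans (sym g₀≡c) g₀≡j)))
  injective-fromMinor total′ injective′ {suc r} {suc s} {c} gr≡c gs≡c with j ≟ c
  ... | yes refl = ⊥-elim (minorMap-total⇒misses total′ r gr≡c)
  ... | no j≢c   = cong suc (injective′ (punchOut-≢ gr≡c) (punchOut-≢ gs≡c))
    where
    punchOut-≢ : ∀ {t} → g (suc t) ≡ just c → minorMap j g t ≡ just (punchOut j≢c)
    punchOut-≢ gt≡c = trans (cong (punchOutMaybe j) gt≡c) (punchOutMaybe-≢ j≢c)

  totalInjective⇔minorMap : (Total g × PartialInjective g) ⇔
                             (Total (minorMap j g) × PartialInjective (minorMap j g))
  totalInjective⇔minorMap = mk⇔
    (λ (total , injective) → minorMap-total total injective , minorMap-injective injective)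
    (λ (total′ , injective′) → total-fromMinor total′ , injective-fromMinor total′ injective′)

nonSingular⇔totalInjective : ∀ n {M : Matrix n} {g : PartialMap n} → IsMatrixOf M g →
  NonSingular n M ⇔ (Total g × PartialInjective g)
nonSingular⇔totalInjective zero    _ = mk⇔ (λ _ → (λ ()) , λ { {()} }) (λ _ ())
nonSingular⇔totalInjective (suc n) {M} {g} M≅g with g zero in g₀
... | nothing = mk⇔
  (λ nsM → ⊥-elim (nsM (det-zeroRow (suc n) M zero λ c →
             proj₂ (M≅g zero c) (nothing≢just ∘ trans (sym g₀)))))
  (λ (total , _) → ⊥-elim (nothing≢just (trans (sym g₀) (proj₂ (total zero)))))
... | just j = begin
  NonSingular (suc n) M
    ≈⟨ nonSingular⇔-signed M (minor j M) (toℕ j) (det-isMatrixOf M≅g g₀) ⟩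
  NonSingular n (minor j M)
    ≈⟨ nonSingular⇔totalInjective n (isMatrixOf-minor j M≅g) ⟩
  (Total (minorMap j g) × PartialInjective (minorMap j g))
    ≈⟨ ⇔-sym (totalInjective⇔minorMap g₀) ⟩
  (Total g × PartialInjective g) ∎
  where open SetoidReasoning (⇔-setoid 0ℓ)

nonSingular⇔injective : ∀ n {M : Matrix n} {f : Fin n → Fin n} → IsMatrixOf M (just ∘ f) →
  NonSingular n M ⇔ Injective _≡_ _≡_ f
nonSingular⇔injective n {f = f} M≅f = totalInjective⇔injective ⇔-∘ nonSingular⇔totalInjective n M≅f
  where
  totalInjective⇔injective : (Total (just ∘ f) × PartialInjective (just ∘ f)) ⇔ Injective _≡_ _≡_ f
  totalInjective⇔injective = mk⇔
    (λ (_ , injective) {x} {y} fx≡fy → injective (cong just fx≡fy) refl)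
    (λ injective → (λ r → f r , refl) ,
                   λ {r} {s} {c} fr≡c fs≡c → injective (just-injective (trans fr≡c (sym fs≡c))))

isMatrixOf-adjacency : ∀ {n k} (σ : Fin k → Fin n → Fin n) i → IsMatrixOf (adjacency σ i) (just ∘ σ i)
isMatrixOf-adjacency σ i r c with σ i r ≟ c
... | yes σr≡c = (λ _ → refl) , (λ σr≢c → ⊥-elim (σr≢c (cong just σr≡c)))
... | no  σr≢c = (λ σr≡c → ⊥-elim (σr≢c (just-injective σr≡c))) , (λ _ → refl)

lookup-tabulate-∘ₘ : ∀ {n} (f : Fin n → Fin n) (u : Map n) c →
  lookup (tabulate f ∘ₘ u) c ≡ f (lookup u c)
lookup-tabulate-∘ₘ f u c =
  trans (lookup-map c (lookup (tabulate f)) u) (lookup∘tabulate f (lookup u c))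

tabulate-∘ₘ-cancelˡ : ∀ {n} {f : Fin n → Fin n} → Injective _≡_ _≡_ f →
  ∀ {u v} → tabulate f ∘ₘ u ≡ tabulate f ∘ₘ v → u ≡ v
tabulate-∘ₘ-cancelˡ {f = f} f-injective {u} {v} fu≡fv = Pointwise-≡⇒≡ (ext λ c → f-injective (begin
  f (lookup u c)                 ≡⟨ sym (lookup-tabulate-∘ₘ f u c) ⟩
  lookup (tabulate f ∘ₘ u) c     ≡⟨ cong (λ w → lookup w c) fu≡fv ⟩
  lookup (tabulate f ∘ₘ v) c     ≡⟨ lookup-tabulate-∘ₘ f v c ⟩
  f (lookup v c)                 ∎))
  where open ≡-Reasoning

tabulate-∘ₘ≡idMap⇒rightInverse : ∀ {n} {f : Fin n → Fin n} {u} → tabulate f ∘ₘ u ≡ idMap →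
  ∀ c → f (lookup u c) ≡ c
tabulate-∘ₘ≡idMap⇒rightInverse {f = f} {u} fu≡id c = begin
  f (lookup u c)                 ≡⟨ sym (lookup-tabulate-∘ₘ f u c) ⟩
  lookup (tabulate f ∘ₘ u) c     ≡⟨ cong (λ w → lookup w c) fu≡id ⟩
  lookup idMap c                 ≡⟨ lookup∘tabulate (λ x → x) c ⟩
  c                              ∎
  where open ≡-Reasoning

module FundamentalNetwork {n k m} (σ : Fin k → Fin n → Fin n) (e : Enumeration σ m) (i : Fin k) where
  open Enumeration e

  σ̃ : Fin m → Fin m
  σ̃ a = proj₁ (surjective (tabulate (σ i) ∘ₘ elt a) (gen-comp (gen-σ i) (elt-in a)))

  elt-σ̃ : ∀ a → elt (σ̃ a) ≡ tabulate (σ i) ∘ₘ elt a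
  elt-σ̃ a = proj₂ (surjective (tabulate (σ i) ∘ₘ elt a) (gen-comp (gen-σ i) (elt-in a)))

  isMatrixOf-fundamentalAdjacency : IsMatrixOf (fundamentalAdjacency σ e i) (just ∘ σ̃)
  isMatrixOf-fundamentalAdjacency a b with (tabulate (σ i) ∘ₘ elt a) ≟ₘ elt b
  ... | yes σa≡b =
      (λ _ → refl)
    , (λ σ̃a≢b → ⊥-elim (σ̃a≢b (cong just (injective (σ̃ a) b (trans (elt-σ̃ a) σa≡b)))))
  ... | no  σa≢b =
      (λ σ̃a≡b → ⊥-elim (σa≢b (trans (sym (elt-σ̃ a)) (cong elt (just-injective σ̃a≡b)))))
    , (λ _ → refl)

  σ-injective⇒σ̃-injective : Injective _≡_ _≡_ (σ i) → Injective _≡_ _≡_ σ̃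
  σ-injective⇒σ̃-injective σ-injective {a} {b} σ̃a≡σ̃b =
    injective a b (tabulate-∘ₘ-cancelˡ σ-injective
      (trans (sym (elt-σ̃ a)) (trans (cong elt σ̃a≡σ̃b) (elt-σ̃ b))))

  σ̃-injective⇒σ-injective : Injective _≡_ _≡_ σ̃ → Injective _≡_ _≡_ (σ i)
  σ̃-injective⇒σ-injective σ̃-injective
    with id̃ , elt-id̃ ← surjective idMap gen-id
    with γ , σ̃γ≡id̃ ← injective⇒surjective σ̃-injective id̃
    = rightInverse⇒injective (tabulate-∘ₘ≡idMap⇒rightInverse
        (trans (sym (elt-σ̃ γ)) (trans (cong elt σ̃γ≡id̃) elt-id̃)))

mainTheorem17 : (n k : ℕ) (σ : Fin k → Fin n → Fin n) (i : Fin k)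
    (m : ℕ) (e : Enumeration σ m) →
    (NonSingular n (adjacency σ i) → NonSingular m (fundamentalAdjacency σ e i))
    × (NonSingular m (fundamentalAdjacency σ e i) → NonSingular n (adjacency σ i))
mainTheorem17 n k σ i m e = Equivalence.to nonSingular⇔ , Equivalence.from nonSingular⇔
  where
  open FundamentalNetwork σ e i
  open SetoidReasoning (⇔-setoid 0ℓ)

  nonSingular⇔ : NonSingular n (adjacency σ i) ⇔ NonSingular m (fundamentalAdjacency σ e i)
  nonSingular⇔ = begin
    NonSingular n (adjacency σ i)
      ≈⟨ nonSingular⇔injective n (isMatrixOf-adjacency σ i) ⟩
    Injective _≡_ _≡_ (σ i)
      ≈⟨ mk⇔ σ-injective⇒σ̃-injective σ̃-injective⇒σ-injective ⟩
    Injective _≡_ _≡_ σ̃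
      ≈⟨ ⇔-sym (nonSingular⇔injective m isMatrixOf-fundamentalAdjacency) ⟩
    NonSingular m (fundamentalAdjacency σ e i) ∎
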